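{- Let $G$ be a finite, simple, connected chordal graph, and let $C_1, C_2, C_3$ be maximal cliques of $G$ such that $S = C_1 \cap C_2$ and $U = C_2 \cap C_3$ are minimal separators of $G$ with $S = U$. If the edges $C_1C_2$ and $C_2C_3$ both belong to a same maximal clique tree $T$ of $G$, then $C_1C_3$ is an edge of the reduced clique graph $\mathcal{C}_r(G)$ and $C_1 \cap C_3 = U$.
   Context: A graph is chordal if it has no chordless cycle of length at least $4$. A minimal separator of $G$ is a set $S$ of vertices for which there exist vertices $a,b$ that are in different connected components of $G - S$, and $S$ is inclusion-minimal with this property (for that pair). A maximal clique is a complete subgraph maximal under inclusion. The reduced clique graph $\mathcal{C}_r(G)$ is the graph whose vertices are the maximal cliques of $G$, where two maximal cliques $C, C'$ are adjacent iff for every $x \in C \setminus (C\cap C')$ and every $y \in C' \setminus (C \cap C')$, the set $C \cap C'$ is a minimal separator for $x$ and $y$ in $G$. A maximal clique tree of $G$ is a tree $T$ whose vertices are the maximal cliques of $G$, whose edges $CC'$ correspond to minimal separators $C\cap C'$ of $G$, and such that for every vertex $x$ of $G$ the maximal cliques containing $x$ induce a subtree of $T$. -}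

module Defs where

open import Data.Nat using (ℕ; zero; suc; _≥_)
open import Data.Fin using (Fin; toℕ)
open import Data.Fin.Subset using (Subset; _∈_; _∉_; _⊂_; _⊆_; _∩_; ∁; ⊤)
open import Data.List using (List; length; removeAt; lookup)
open import Data.List.Membership.Propositional using () renaming (_∈_ to _∈ₗ_)
open import Data.Unit using () renaming (⊤ to Unit)
open import Data.Product using (Σ; ∃; ∃₂; _×_; _,_; proj₁; proj₂)
open import Data.Sum using (_⊎_)
open import Function.Definitions using (Injective)
open import Relation.Nullary using (¬_; Dec)
open import Relation.Binary.PropositionalEquality using (_≡_; _≢_)

record Graph (n : ℕ) : Set₁ where
  field
    Adj    : Fin n → Fin n → Set
    sym    : ∀ {x y} → Adj x y → Adj y x
    irrefl : ∀ {x} → ¬ Adj x x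
    dec    : ∀ x y → Dec (Adj x y)

module _ {n : ℕ} (G : Graph n) where
  open Graph G

  data ReachIn (X : Subset n) (a : Fin n) : Fin n → Set where
    here : a ∈ X → ReachIn X a a
    step : ∀ {c b} → ReachIn X a c → Adj c b → b ∈ X → ReachIn X a b

  Connected : Set
  Connected = ∀ a b → ReachIn ⊤ a b

  Separates : Subset n → Fin n → Fin n → Set
  Separates S a b = a ∉ S × b ∉ S × ¬ ReachIn (∁ S) a b

  MinSepFor : Subset n → Fin n → Fin n → Set
  MinSepFor S a b = Separates S a b × (∀ S' → S' ⊂ S → ¬ Separates S' a b)

  MinimalSeparator : Subset n → Set
  MinimalSeparator S = ∃₂ λ a b → MinSepFor S a b

  IsClique : Subset n → Set
  IsClique C = ∀ {x y} → x ∈ C → y ∈ C → x ≢ y → Adj x y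

  MaximalClique : Subset n → Set
  MaximalClique C = IsClique C × (∀ C' → IsClique C' → C ⊆ C' → C' ⊆ C)

  CycAdj : ∀ {k} → Fin k → Fin k → Set
  CycAdj {k} i j = suc (toℕ i) ≡ toℕ j ⊎ suc (toℕ j) ≡ toℕ i
                 ⊎ (toℕ i ≡ 0 × suc (toℕ j) ≡ k) ⊎ (toℕ j ≡ 0 × suc (toℕ i) ≡ k)

  ChordlessCycle : ℕ → Set
  ChordlessCycle k = Σ (Fin k → Fin n) λ f → Injective _≡_ _≡_ f ×
                       (∀ i j → CycAdj i j → Adj (f i) (f j)) ×
                       (∀ i j → Adj (f i) (f j) → CycAdj i j)

  Chordal : Set
  Chordal = ∀ k → k ≥ 4 → ¬ ChordlessCycle k

  ReducedCliqueEdge : Subset n → Subset n → Set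
  ReducedCliqueEdge C C' = MaximalClique C × MaximalClique C' × C ≢ C' ×
    (∀ x y → x ∈ C → x ∉ (C ∩ C') → y ∈ C' → y ∉ (C ∩ C') → MinSepFor (C ∩ C') x y)

  TEdge : List (Subset n × Subset n) → Subset n → Subset n → Set
  TEdge L C D = (C , D) ∈ₗ L ⊎ (D , C) ∈ₗ L

  data PathIn (P : Subset n → Set) (L : List (Subset n × Subset n)) (C : Subset n)
       : Subset n → Set where
    here : P C → PathIn P L C C
    step : ∀ {D E} → PathIn P L C D → TEdge L D E → P E → PathIn P L C E

  Any' : Subset n → Set
  Any' _ = Unit

  -- L is a tree whose vertex set is the set of maximal cliques of G:
  -- endpoints are maximal cliques, it is connected, and every edge is a
  -- bridge (removing it disconnects its endpoints); this excludes loops,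
  -- multiple edges and cycles.
  IsCliqueTree : List (Subset n × Subset n) → Set
  IsCliqueTree L =
    (∀ {C D} → (C , D) ∈ₗ L → MaximalClique C × MaximalClique D) ×
    (∀ C D → MaximalClique C → MaximalClique D → PathIn Any' L C D) ×
    (∀ (i : Fin (length L)) →
       ¬ PathIn Any' (removeAt L i) (proj₁ (lookup L i)) (proj₂ (lookup L i)))

  MaxCliqueTree : List (Subset n × Subset n) → Set
  MaxCliqueTree L = IsCliqueTree L ×
    (∀ {C D} → (C , D) ∈ₗ L → MinimalSeparator (C ∩ D)) ×
    (∀ x C D → x ∈ C → x ∈ D → MaximalClique C → MaximalClique D →
       PathIn (λ E → x ∈ E) L C D)

module Submission where

-- Let T be a maximal clique tree containing the edges C₁C₂ and
-- C₂C₃, and let R be T with the edge C₁C₂ removed.  Call a maximal clique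
-- D on C₁'s side if R contains a path from C₁ to D.  Since C₁C₂ is a
-- bridge, C₂ is not on C₁'s side, and neither is its other neighbour C₃.
--   * A vertex x outside S = C₁ ∩ C₂ lying in two maximal cliques D, D'
--     puts them on the same side: the path of cliques containing x from D
--     to D' (clique-intersection property) cannot use the edge C₁C₂.
--   * Hence C₁ ∩ C₃ ⊆ C₂, so C₁ ∩ C₃ = S = C₂ ∩ C₃ (as S = U).
--   * Walking along a path of G - S from x ∈ C₁ and covering each of its
--     edges by a maximal clique, every clique met stays on C₁'s side; so no
--     such path reaches C₃ ∖ S, i.e. S separates C₁ ∖ S from C₃ ∖ S.
--   * No proper subset S' of S separates them: for s ∈ S ∖ S', x – s – y
--     is a path avoiding S', since S ⊆ C₁ ∩ C₃ and both are cliques.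

open import Defs
open import Data.Nat using (ℕ)
open import Data.Fin using (Fin; zero; suc; _≟_)
open import Data.Fin.Subset using (Subset; _∩_; _∪_; _∈_; _∉_; _⊆_; _⊂_; ∁; ⁅_⁆)
open import Data.Fin.Subset.Properties
  using (_∈?_; x∈p∩q⁺; x∈p∩q⁻; x∈p∪q⁺; x∈p∪q⁻; p⊆p∪q; x∈⁅x⁆; x∈⁅y⁆⇒x≡y;
         ⊆-antisym; ⊆-reflexive; x∈∁p⇒x∉p; x∉p⇒x∈∁p)
open import Data.Fin.Properties using (all?)
open import Data.List using (List; []; _∷_; length; removeAt; lookup; allFin)
open import Data.List.Relation.Unary.Any using (here; there; index)
open import Data.List.Relation.Unary.Any.Properties using (lookup-index)
open import Data.List.Membership.Propositional using () renaming (_∈_ to _∈ₗ_)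
open import Data.List.Membership.Propositional.Properties using (∈-allFin)
open import Data.Product using (Σ; _×_; _,_; proj₁; proj₂; swap)
open import Data.Sum using (_⊎_; inj₁; inj₂)
open import Data.Empty using (⊥-elim)
open import Data.Unit using (tt)
open import Function using (_∘_)
open import Relation.Nullary using (¬_; Dec; yes; no)
open import Relation.Nullary.Decidable.Core using (_→-dec_; ¬?)
open import Relation.Binary.PropositionalEquality using (_≡_; _≢_; refl; sym; trans; subst)

∈-removeAt : ∀ {a} {A : Set a} (L : List A) (i : Fin (length L)) {x : A} →
  x ∈ₗ L → lookup L i ≡ x ⊎ x ∈ₗ removeAt L i
∈-removeAt (y ∷ ys) zero    (here x≡y)  = inj₁ (sym x≡y)
∈-removeAt (y ∷ ys) zero    (there x∈)  = inj₂ x∈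
∈-removeAt (y ∷ ys) (suc j) (here x≡y)  = inj₂ (here x≡y)
∈-removeAt (y ∷ ys) (suc j) (there x∈) with ∈-removeAt ys j x∈
... | inj₁ removed = inj₁ removed
... | inj₂ kept    = inj₂ (there kept)

module _ {n : ℕ} (G : Graph n) where
  open Graph G renaming (sym to Adj-sym)

  EdgeList : Set
  EdgeList = List (Subset n × Subset n)

  TEdge-sym : ∀ {L C D} → TEdge G L C D → TEdge G L D C
  TEdge-sym (inj₁ e) = inj₂ e
  TEdge-sym (inj₂ e) = inj₁ e

  path-last : ∀ {P L A B} → PathIn G P L A B → P B
  path-last (here pA)     = pA
  path-last (step _ _ pB) = pB

  path-++ : ∀ {P L A B C} → PathIn G P L A B → PathIn G P L B C → PathIn G P L A C
  path-++ p (here _)       = p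
  path-++ p (step q e pC)  = step (path-++ p q) e pC

  path-reverse : ∀ {P L A B} → PathIn G P L A B → PathIn G P L B A
  path-reverse (here pA)     = here pA
  path-reverse (step q e pB) = path-++ (step (here pB) (TEdge-sym e) (path-last q)) (path-reverse q)

  path-forget : ∀ {P L A B} → PathIn G P L A B → PathIn G (Any' G) L A B
  path-forget (here _)     = here tt
  path-forget (step q e _) = step (path-forget q) e tt

  -- A path whose nodes all satisfy P cannot use an edge whose two endpoints
  -- do not both satisfy P, so it survives the removal of such an edge.
  path-dropEdge : ∀ {P L A B} (i : Fin (length L)) →
    ¬ (P (proj₁ (lookup L i)) × P (proj₂ (lookup L i))) →
    PathIn G P L A B → PathIn G P (removeAt L i) A B
  path-dropEdge i bad (here pA) = here pA
  path-dropEdge {P} {L} i bad (step {D} {E} q e pE) =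
    step (path-dropEdge i bad q) (keep e) pE
    where
    survives : ∀ {X Y} → P X → P Y → (X , Y) ∈ₗ L → (X , Y) ∈ₗ removeAt L i
    survives pX pY XY∈L with ∈-removeAt L i XY∈L
    ... | inj₁ removed = ⊥-elim (bad (subst (λ e → P (proj₁ e) × P (proj₂ e)) (sym removed) (pX , pY)))
    ... | inj₂ kept    = kept
    keep : TEdge G L D E → TEdge G (removeAt L i) D E
    keep (inj₁ DE∈L) = inj₁ (survives (path-last q) pE DE∈L)
    keep (inj₂ ED∈L) = inj₂ (survives pE (path-last q) ED∈L)

  singleton-clique : ∀ c → IsClique G ⁅ c ⁆
  singleton-clique c x∈ y∈ x≢y = ⊥-elim (x≢y (trans (x∈⁅y⁆⇒x≡y c x∈) (sym (x∈⁅y⁆⇒x≡y c y∈))))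

  Joinable : Subset n → Fin n → Set
  Joinable K z = ∀ u → u ∈ K → u ≢ z → Adj u z

  -- Joinability is decidable, which makes greedy extension computable.
  joinable? : ∀ K z → Dec (Joinable K z)
  joinable? K z = all? (λ u → (u ∈? K) →-dec (¬? (u ≟ z) →-dec dec u z))

  add-clique : ∀ {K z} → IsClique G K → Joinable K z → IsClique G (K ∪ ⁅ z ⁆)
  add-clique {K} {z} clK ok x∈ y∈ = go (x∈p∪q⁻ K ⁅ z ⁆ x∈) (x∈p∪q⁻ K ⁅ z ⁆ y∈)
    where
    go : ∀ {x y} → x ∈ K ⊎ x ∈ ⁅ z ⁆ → y ∈ K ⊎ y ∈ ⁅ z ⁆ → x ≢ y → Adj x y
    go (inj₁ xK) (inj₁ yK) x≢y = clK xK yK x≢y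
    go {x} (inj₁ xK) (inj₂ y≡z) x≢y with x∈⁅y⁆⇒x≡y z y≡z
    ... | refl = ok x xK x≢y
    go {y = y} (inj₂ x≡z) (inj₁ yK) x≢y with x∈⁅y⁆⇒x≡y z x≡z
    ... | refl = Adj-sym (ok y yK (x≢y ∘ sym))
    go (inj₂ x≡z) (inj₂ y≡z) x≢y = singleton-clique z x≡z y≡z x≢y

  addIfJoinable : Subset n → Fin n → Subset n
  addIfJoinable K z with joinable? K z
  ... | yes _ = K ∪ ⁅ z ⁆
  ... | no _  = K

  greedy : Subset n → List (Fin n) → Subset n
  greedy K []       = K
  greedy K (z ∷ zs) = greedy (addIfJoinable K z) zs

  addIfJoinable-⊆ : ∀ K z → K ⊆ addIfJoinable K z
  addIfJoinable-⊆ K z with joinable? K z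
  ... | yes _ = p⊆p∪q ⁅ z ⁆
  ... | no _  = λ x∈ → x∈

  addIfJoinable-clique : ∀ K z → IsClique G K → IsClique G (addIfJoinable K z)
  addIfJoinable-clique K z clK with joinable? K z
  ... | yes ok = add-clique clK ok
  ... | no _   = clK

  greedy-⊆ : ∀ K zs → K ⊆ greedy K zs
  greedy-⊆ K []       x∈ = x∈
  greedy-⊆ K (z ∷ zs) x∈ = greedy-⊆ (addIfJoinable K z) zs (addIfJoinable-⊆ K z x∈)

  greedy-clique : ∀ K zs → IsClique G K → IsClique G (greedy K zs)
  greedy-clique K []       clK = clK
  greedy-clique K (z ∷ zs) clK = greedy-clique (addIfJoinable K z) zs (addIfJoinable-clique K z clK)

  greedy-saturated : ∀ K zs {z} → z ∈ₗ zs → Joinable (greedy K zs) z → z ∈ greedy K zs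
  greedy-saturated K (z ∷ zs) (here refl) ok with joinable? K z
  ... | yes _   = greedy-⊆ (K ∪ ⁅ z ⁆) zs (x∈p∪q⁺ (inj₂ (x∈⁅x⁆ z)))
  ... | no ¬ok  = ⊥-elim (¬ok (λ u uK → ok u (greedy-⊆ K zs uK)))
  greedy-saturated K (w ∷ zs) (there z∈) ok = greedy-saturated (addIfJoinable K w) zs z∈ ok

  extend-to-maximal : ∀ {K} → IsClique G K → Σ (Subset n) λ D → MaximalClique G D × K ⊆ D
  extend-to-maximal {K} clK = D , (greedy-clique K (allFin n) clK , maximal) , greedy-⊆ K (allFin n)
    where
    D = greedy K (allFin n)
    maximal : ∀ D' → IsClique G D' → D ⊆ D' → D' ⊆ D
    maximal D' clD' D⊆D' {z} zD' =
      greedy-saturated K (allFin n) (∈-allFin z) (λ u uD u≢z → clD' (D⊆D' uD) zD' u≢z)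

  edge-in-maximal-clique : ∀ {c b} → Adj c b → Σ (Subset n) λ D → MaximalClique G D × c ∈ D × b ∈ D
  edge-in-maximal-clique {c} {b} cb with extend-to-maximal (add-clique (singleton-clique c) joinable)
    where
    joinable : Joinable ⁅ c ⁆ b
    joinable u u∈ _ with x∈⁅y⁆⇒x≡y c u∈
    ... | refl = cb
  ... | D , mD , ⊆D = D , mD , ⊆D (x∈p∪q⁺ (inj₁ (x∈⁅x⁆ c))) , ⊆D (x∈p∪q⁺ (inj₂ (x∈⁅x⁆ b)))

  -- If every vertex of S is adjacent to both x and y, no proper subset S' of
  -- S separates x from y: any s ∈ S ∖ S' gives the path x – s – y.
  common-neighbours-minimal : ∀ {C D S x y} → IsClique G C → IsClique G D →
    x ∈ C → y ∈ D → x ∉ S → y ∉ S → S ⊆ C ∩ D →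
    ∀ S' → S' ⊂ S → ¬ Separates G S' x y
  common-neighbours-minimal {C} {D} {S} clC clD xC yD x∉S y∉S S⊆CD S' (_ , s , sS , s∉S') (x∉S' , y∉S' , ¬path) =
    ¬path (step (step (here (x∉p⇒x∈∁p x∉S')) (clC xC sC x≢s) (x∉p⇒x∈∁p s∉S'))
                (clD sD yD s≢y) (x∉p⇒x∈∁p y∉S'))
    where
    sC = proj₁ (x∈p∩q⁻ C D (S⊆CD sS))
    sD = proj₂ (x∈p∩q⁻ C D (S⊆CD sS))
    x≢s : _ ≢ s
    x≢s x≡s = x∉S (subst (_∈ S) (sym x≡s) sS)
    s≢y : s ≢ _
    s≢y s≡y = y∉S (subst (_∈ S) s≡y sS)

  edge-maximal : ∀ {L C D} → IsCliqueTree G L → TEdge G L C D →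
    MaximalClique G C × MaximalClique G D
  edge-maximal tree (inj₁ CD∈L) = proj₁ tree CD∈L
  edge-maximal tree (inj₂ DC∈L) = swap (proj₁ tree DC∈L)

  edge-position : ∀ {L C D} → TEdge G L C D →
    Σ (Fin (length L)) λ i → lookup L i ≡ (C , D) ⊎ lookup L i ≡ (D , C)
  edge-position (inj₁ CD∈L) = index CD∈L , inj₁ (sym (lookup-index CD∈L))
  edge-position (inj₂ DC∈L) = index DC∈L , inj₂ (sym (lookup-index DC∈L))

  module TreeEdge (T : EdgeList) (mct : MaxCliqueTree G T)
                  {C₁ C₂ : Subset n} (e₁₂ : TEdge G T C₁ C₂) where

    S : Subset n
    S = C₁ ∩ C₂

    i : Fin (length T)
    i = proj₁ (edge-position e₁₂)

    R : EdgeList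
    R = removeAt T i

    Side : Subset n → Set
    Side D = PathIn G (Any' G) R C₁ D

    C₁-maximal : MaximalClique G C₁
    C₁-maximal = proj₁ (edge-maximal (proj₁ mct) e₁₂)

    removed-ends : ∀ {P : Subset n → Set} → ¬ (P C₁ × P C₂) →
      ¬ (P (proj₁ (lookup T i)) × P (proj₂ (lookup T i)))
    removed-ends bad with lookup T i | proj₂ (edge-position e₁₂)
    ... | _ | inj₁ refl = bad
    ... | _ | inj₂ refl = bad ∘ swap

    -- C₁C₂ is a bridge of T.
    C₂-off : ¬ Side C₂
    C₂-off p with lookup T i | proj₂ (edge-position e₁₂) | proj₂ (proj₂ (proj₁ mct)) i
    ... | _ | inj₁ refl | bridge = bridge p
    ... | _ | inj₂ refl | bridge = bridge (path-reverse p)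

    neighbour-off : ∀ {D} → D ≢ C₁ → TEdge G T C₂ D → ¬ Side D
    neighbour-off {D} D≢C₁ e₂D sideD =
      C₂-off (path-++ sideD (path-reverse (path-forget (path-dropEdge i (removed-ends notC₁) C₂D))))
      where
      notC₁ : ¬ (C₁ ≢ C₁ × C₂ ≢ C₁)
      notC₁ (C₁≢C₁ , _) = C₁≢C₁ refl
      C₂≢C₁ : C₂ ≢ C₁
      C₂≢C₁ C₂≡C₁ = C₂-off (subst Side (sym C₂≡C₁) (here tt))
      C₂D : PathIn G (_≢ C₁) T C₂ D
      C₂D = step (here C₂≢C₁) e₂D D≢C₁

    -- Two maximal cliques sharing a vertex outside S lie on the same side:
    -- the cliques containing that vertex form a subtree avoiding C₁C₂.
    side-transport : ∀ {x D D'} → x ∉ S → MaximalClique G D → MaximalClique G D' →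
      x ∈ D → x ∈ D' → Side D → Side D'
    side-transport {x} {D} {D'} x∉S mD mD' xD xD' sideD =
      path-++ sideD (path-forget (path-dropEdge i (removed-ends (x∉S ∘ x∈p∩q⁺))
                                  (proj₂ (proj₂ mct) x D D' xD xD' mD mD')))

    off-side-meet : ∀ {D} → MaximalClique G D → ¬ Side D → C₁ ∩ D ⊆ C₂
    off-side-meet {D} mD off {x} x∈C₁D with x ∈? C₂
    ... | yes x∈C₂ = x∈C₂
    ... | no x∉C₂  = ⊥-elim (off (side-transport (x∉C₂ ∘ proj₂ ∘ x∈p∩q⁻ C₁ C₂)
                                   C₁-maximal mD (proj₁ xC₁D) (proj₂ xC₁D) (here tt)))
      where xC₁D = x∈p∩q⁻ C₁ D x∈C₁D

    -- Along a path of G - S starting in C₁, every maximal clique containing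
    -- the current vertex is on C₁'s side (cover each step by a maximal clique).
    reach-side : ∀ {x v D} → x ∈ C₁ → ReachIn G (∁ S) x v → MaximalClique G D → v ∈ D → Side D
    reach-side xC₁ (here x∉S) mD xD = side-transport (x∈∁p⇒x∉p x∉S) C₁-maximal mD xC₁ xD (here tt)
    reach-side xC₁ (step r cb b∉S) mD bD with edge-in-maximal-clique cb
    ... | D' , mD' , cD' , bD' = side-transport (x∈∁p⇒x∉p b∉S) mD' mD bD' bD (reach-side xC₁ r mD' cD')

    separates : ∀ {x y D} → MaximalClique G D → ¬ Side D →
      x ∈ C₁ → x ∉ S → y ∈ D → y ∉ S → Separates G S x y
    separates mD off xC₁ x∉S yD y∉S = x∉S , y∉S , λ r → off (reach-side xC₁ r mD yD)

lemma5 : ∀ {n} (G : Graph n) → Connected G → Chordal G →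
    (C₁ C₂ C₃ : Subset n) →
    MaximalClique G C₁ → MaximalClique G C₂ → MaximalClique G C₃ →
    MinimalSeparator G (C₁ ∩ C₂) → MinimalSeparator G (C₂ ∩ C₃) →
    C₁ ∩ C₂ ≡ C₂ ∩ C₃ → C₁ ≢ C₃ →
    (T : List (Subset n × Subset n)) → MaxCliqueTree G T →
    TEdge G T C₁ C₂ → TEdge G T C₂ C₃ →
    ReducedCliqueEdge G C₁ C₃ × C₁ ∩ C₃ ≡ C₂ ∩ C₃
lemma5 G _ _ C₁ C₂ C₃ m₁ _ m₃ _ _ S≡U C₁≢C₃ T mct e₁₂ e₂₃ =
  (m₁ , m₃ , C₁≢C₃ , minSep) , trans C₁∩C₃≡S S≡U
  where
  open TreeEdge G T mct e₁₂

  C₃-off : ¬ Side C₃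
  C₃-off = neighbour-off (C₁≢C₃ ∘ sym) e₂₃

  -- C₁ ∩ C₃ ⊆ C₂ as C₃ is off C₁'s side; conversely S = U ⊆ C₃.
  C₁∩C₃≡S : C₁ ∩ C₃ ≡ S
  C₁∩C₃≡S = ⊆-antisym
    (λ x∈ → x∈p∩q⁺ (proj₁ (x∈p∩q⁻ C₁ C₃ x∈) , off-side-meet m₃ C₃-off x∈))
    (λ x∈ → x∈p∩q⁺ (proj₁ (x∈p∩q⁻ C₁ C₂ x∈) , proj₂ (x∈p∩q⁻ C₂ C₃ (subst (_ ∈_) S≡U x∈))))

  -- S separates C₁ ∖ S from C₃ ∖ S, and minimally so since S ⊆ C₁ ∩ C₃.
  minSep : ∀ x y → x ∈ C₁ → x ∉ C₁ ∩ C₃ → y ∈ C₃ → y ∉ C₁ ∩ C₃ → MinSepFor G (C₁ ∩ C₃) x y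
  minSep x y xC₁ x∉ yC₃ y∉ rewrite C₁∩C₃≡S =
    separates m₃ C₃-off xC₁ x∉ yC₃ y∉ ,
    common-neighbours-minimal G (proj₁ m₁) (proj₁ m₃) xC₁ yC₃ x∉ y∉ (⊆-reflexive (sym C₁∩C₃≡S))
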